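{- Let $s$ be a positive integer and let $G$ be a graph which does not contain $K_{s,s}$ as a subgraph. Then for every set $W\subseteq V(G)$ with $|W|\ge 2s$, there are at most $s$ vertices $v\in V(G)$ for which $|W\setminus N(v)|\le |W|/(2s)$.
   Context: $N(v)$ denotes the neighbourhood of $v$ in $G$. -}

module Defs where

open import Data.Nat using (ℕ; _*_; _≤_)
open import Data.Bool using (Bool; true; false)
open import Data.Fin using (Fin)
open import Data.Fin.Subset using (Subset; _∈_; _∩_; ∁; ∣_∣; Empty)
open import Data.Vec using (tabulate)
open import Data.Product using (_×_; Σ; ∃₂)
open import Relation.Binary.PropositionalEquality using (_≡_; _≢_)

record Graph (n : ℕ) : Set where
  field
    adj   : Fin n → Fin n → Bool
    sym   : ∀ u v → adj u v ≡ adj v u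
    irrefl : ∀ v → adj v v ≡ false

open Graph public

N : ∀ {n} → Graph n → Fin n → Subset n
N G v = tabulate (λ u → adj G v u)

Disjoint : ∀ {n} → Subset n → Subset n → Set
Disjoint A B = Empty (A ∩ B)

ContainsKss : ∀ {n} → Graph n → ℕ → Set
ContainsKss {n} G s =
  ∃₂ λ (A B : Subset n) →
    (∣ A ∣ ≡ s) × (∣ B ∣ ≡ s) × Disjoint A B ×
    (∀ a b → a ∈ A → b ∈ B → adj G a b ≡ true)

-- W \ N(v) = W ∩ complement of N(v); condition |W \ N(v)| ≤ |W|/(2s),
-- written without division as 2s · |W \ N(v)| ≤ |W|.
Close : ∀ {n} → Graph n → ℕ → Subset n → Fin n → Set
Close G s W v = 2 * s * ∣ W ∩ ∁ (N G v) ∣ ≤ ∣ W ∣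

-- Suppose s + 1 vertices each miss at most |W|/(2s) vertices of W, and take s of
-- them, forming a set A.  By the union bound the common neighbourhood of A inside W
-- lacks at most s · |W|/(2s) = |W|/2 vertices of W, so it has at least |W|/2 ≥ s
-- vertices; any s of them, together with A, span a K_{s,s}.  The two sides are
-- disjoint because G has no loops.
module Submission where

open import Defs hiding (sym)
open import Data.Bool using (true)
open import Data.Nat using (ℕ; zero; suc; _+_; _*_; _≤_; NonZero; s≤s; _≤?_)
open import Data.Nat.Properties
open import Data.Nat.ListAction using (sum)
open import Data.Fin using (Fin)
import Data.Fin as Fin
open import Data.Fin.Subset using (Subset; _∈_; _⊆_; ∣_∣; _∩_; ∁; ⊥; ⋂; inside; outside)
open import Data.Fin.Subset.Properties
  using (⊥⊆; ∣⊥∣≡0; p⊆q⇒∣p∣≤∣q∣; p∩q⊆p; x∈p∩q⁺; x∈p∩q⁻; ∩-assoc; ∩-comm; ∩-identityʳ)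
open import Data.Vec using ([]; _∷_; here; there)
open import Data.Vec.Properties using ([]=⇒lookup; lookup∘tabulate)
open import Data.List using (List; []; _∷_; map; length)
open import Data.List.Properties using (length-map)
open import Data.List.Membership.Propositional using () renaming (_∈_ to _∈ₗ_)
open import Data.List.Membership.Propositional.Properties using (∈-map⁺; ∈-map⁻)
open import Data.List.Relation.Unary.Any using (here; there)
open import Data.List.Relation.Unary.All as All using (All; []; _∷_)
import Data.List.Relation.Unary.All.Properties as All
open import Data.Product using (_×_; _,_; proj₁; proj₂; uncurry; ∃-syntax)
open import Relation.Nullary using (¬_; yes; no; contradiction)
open import Relation.Binary.PropositionalEquality

private
  variable
    n : ℕ

subset-of-size : ∀ k (p : Subset n) → k ≤ ∣ p ∣ → ∃[ q ] q ⊆ p × ∣ q ∣ ≡ k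
subset-of-size {n} zero p _ = ⊥ , ⊥⊆ , ∣⊥∣≡0 n
subset-of-size (suc k) (outside ∷ p) k<∣p∣ with subset-of-size (suc k) p k<∣p∣
... | q , q⊆p , ∣q∣≡k = outside ∷ q , (λ { (there x∈q) → there (q⊆p x∈q) }) , ∣q∣≡k
subset-of-size (suc k) (inside ∷ p) (s≤s k≤∣p∣) with subset-of-size k p k≤∣p∣
... | q , q⊆p , ∣q∣≡k =
  inside ∷ q , (λ { here → here ; (there x∈q) → there (q⊆p x∈q) }) , cong suc ∣q∣≡k

∣p∣≡∣p∩q∣+∣p∩∁q∣ : (p q : Subset n) → ∣ p ∣ ≡ ∣ p ∩ q ∣ + ∣ p ∩ ∁ q ∣
∣p∣≡∣p∩q∣+∣p∩∁q∣ []            []            = refl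
∣p∣≡∣p∩q∣+∣p∩∁q∣ (outside ∷ p) (_ ∷ q)       = ∣p∣≡∣p∩q∣+∣p∩∁q∣ p q
∣p∣≡∣p∩q∣+∣p∩∁q∣ (inside ∷ p)  (inside ∷ q)  = cong suc (∣p∣≡∣p∩q∣+∣p∩∁q∣ p q)
∣p∣≡∣p∩q∣+∣p∩∁q∣ (inside ∷ p)  (outside ∷ q) =
  trans (cong suc (∣p∣≡∣p∩q∣+∣p∩∁q∣ p q)) (sym (+-suc _ _))

elements : Subset n → List (Fin n)
elements []            = []
elements (inside ∷ p)  = Fin.zero ∷ map Fin.suc (elements p)
elements (outside ∷ p) = map Fin.suc (elements p)

length-elements : (p : Subset n) → length (elements p) ≡ ∣ p ∣
length-elements []            = refl
length-elements (inside ∷ p)  = cong suc (trans (length-map Fin.suc (elements p)) (length-elements p))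
length-elements (outside ∷ p) = trans (length-map Fin.suc (elements p)) (length-elements p)

∈-elements⁺ : ∀ (p : Subset n) {x} → x ∈ p → x ∈ₗ elements p
∈-elements⁺ (inside ∷ p)  here        = here refl
∈-elements⁺ (inside ∷ p)  (there x∈p) = there (∈-map⁺ Fin.suc (∈-elements⁺ p x∈p))
∈-elements⁺ (outside ∷ p) (there x∈p) = ∈-map⁺ Fin.suc (∈-elements⁺ p x∈p)

∈-elements⁻ : ∀ (p : Subset n) {x} → x ∈ₗ elements p → x ∈ p
∈-elements⁻ (inside ∷ p)  (here refl) = here
∈-elements⁻ (inside ∷ p)  (there x∈ₗ) with ∈-map⁻ Fin.suc x∈ₗ
... | _ , y∈ₗ , refl = there (∈-elements⁻ p y∈ₗ)
∈-elements⁻ (outside ∷ p) x∈ₗ with ∈-map⁻ Fin.suc x∈ₗ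
... | _ , y∈ₗ , refl = there (∈-elements⁻ p y∈ₗ)

∈⋂⇒∈ : ∀ {x : Fin n} {q} qs → x ∈ ⋂ qs → q ∈ₗ qs → x ∈ q
∈⋂⇒∈ (q ∷ qs) x∈⋂ (here refl) = x∈p∩q⁻ q (⋂ qs) x∈⋂ .proj₁
∈⋂⇒∈ (q ∷ qs) x∈⋂ (there q∈qs) = ∈⋂⇒∈ qs (x∈p∩q⁻ q (⋂ qs) x∈⋂ .proj₂) q∈qs

∣p∣≤∣p∩⋂qs∣+∑∣p∩∁q∣ : (p : Subset n) (qs : List (Subset n)) →
                     ∣ p ∣ ≤ ∣ p ∩ ⋂ qs ∣ + sum (map (λ q → ∣ p ∩ ∁ q ∣) qs)
∣p∣≤∣p∩⋂qs∣+∑∣p∩∁q∣ p [] =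
  ≤-reflexive (trans (cong ∣_∣ (sym (∩-identityʳ p))) (sym (+-identityʳ _)))
∣p∣≤∣p∩⋂qs∣+∑∣p∩∁q∣ p (q ∷ qs) = begin
  ∣ p ∣                                  ≤⟨ ∣p∣≤∣p∩⋂qs∣+∑∣p∩∁q∣ p qs ⟩
  ∣ r ∣ + Σ                              ≡⟨ cong (_+ Σ) (∣p∣≡∣p∩q∣+∣p∩∁q∣ r q) ⟩
  ∣ r ∩ q ∣ + ∣ r ∩ ∁ q ∣ + Σ            ≤⟨ +-monoˡ-≤ Σ (+-monoʳ-≤ ∣ r ∩ q ∣ (p⊆q⇒∣p∣≤∣q∣ r∩∁q⊆p∩∁q)) ⟩
  ∣ r ∩ q ∣ + ∣ p ∩ ∁ q ∣ + Σ            ≡⟨ cong (λ t → ∣ t ∣ + ∣ p ∩ ∁ q ∣ + Σ) r∩q≡p∩⋂q∷qs ⟩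
  ∣ p ∩ ⋂ (q ∷ qs) ∣ + ∣ p ∩ ∁ q ∣ + Σ   ≡⟨ +-assoc ∣ p ∩ ⋂ (q ∷ qs) ∣ _ Σ ⟩
  ∣ p ∩ ⋂ (q ∷ qs) ∣ + (∣ p ∩ ∁ q ∣ + Σ) ∎
  where
  open ≤-Reasoning
  r = p ∩ ⋂ qs
  Σ = sum (map (λ q → ∣ p ∩ ∁ q ∣) qs)
  r∩∁q⊆p∩∁q : r ∩ ∁ q ⊆ p ∩ ∁ q
  r∩∁q⊆p∩∁q x∈ = let x∈r , x∈∁q = x∈p∩q⁻ r (∁ q) x∈ in x∈p∩q⁺ (p∩q⊆p p (⋂ qs) x∈r , x∈∁q)
  r∩q≡p∩⋂q∷qs : r ∩ q ≡ p ∩ (q ∩ ⋂ qs)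
  r∩q≡p∩⋂q∷qs = trans (∩-assoc p (⋂ qs) q) (cong (p ∩_) (∩-comm (⋂ qs) q))

*-sum≤length* : ∀ {m c} {xs : List ℕ} → All (λ x → m * x ≤ c) xs → m * sum xs ≤ length xs * c
*-sum≤length* {m} [] = ≤-reflexive (*-zeroʳ m)
*-sum≤length* {m} {c} {x ∷ xs} (mx≤c ∷ bounds) = begin
  m * (x + sum xs)      ≡⟨ *-distribˡ-+ m x (sum xs) ⟩
  m * x + m * sum xs    ≤⟨ +-mono-≤ mx≤c (*-sum≤length* {m} bounds) ⟩
  c + length xs * c     ∎
  where open ≤-Reasoning

≤2*-from-deficit : ∀ {m w c d} .{{_ : NonZero m}} → 2 * m * d ≤ m * w → w ≤ c + d → w ≤ 2 * c
≤2*-from-deficit {m} {w} {c} {d} 2md≤mw w≤c+d =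
  *-cancelˡ-≤ m (+-cancelʳ-≤ (m * w) (m * w) (m * (2 * c)) (begin
    m * w + m * w           ≡⟨ cong (m * w +_) (sym (+-identityʳ (m * w))) ⟩
    2 * (m * w)             ≡⟨ *-assoc 2 m w ⟨
    2 * m * w               ≤⟨ *-monoʳ-≤ (2 * m) w≤c+d ⟩
    2 * m * (c + d)         ≡⟨ *-distribˡ-+ (2 * m) c d ⟩
    2 * m * c + 2 * m * d   ≡⟨ cong (_+ 2 * m * d) 2mc≡m[2c] ⟩
    m * (2 * c) + 2 * m * d ≤⟨ +-monoʳ-≤ (m * (2 * c)) 2md≤mw ⟩
    m * (2 * c) + m * w     ∎))
  where
  open ≤-Reasoning
  2mc≡m[2c] : 2 * m * c ≡ m * (2 * c)
  2mc≡m[2c] = trans (cong (_* c) (*-comm 2 m)) (*-assoc m 2 c)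

module _ (G : Graph n) where

  commonNeighboursIn : Subset n → Subset n → Subset n
  commonNeighboursIn W A = W ∩ ⋂ (map (N G) (elements A))

  ∈N⇒adj : ∀ {a u} → u ∈ N G a → adj G a u ≡ true
  ∈N⇒adj {a} {u} u∈N = trans (sym (lookup∘tabulate (adj G a) u)) ([]=⇒lookup u∈N)

  ∈commonNeighboursIn⇒adj : ∀ {W A a u} → a ∈ A → u ∈ commonNeighboursIn W A → adj G a u ≡ true
  ∈commonNeighboursIn⇒adj {W} {A} a∈A u∈Γ =
    ∈N⇒adj (∈⋂⇒∈ (map (N G) (elements A)) (x∈p∩q⁻ W _ u∈Γ .proj₂)
                 (∈-map⁺ (N G) (∈-elements⁺ A a∈A)))

  ∣W∣≤2*∣commonNeighboursIn∣ : ∀ s .{{_ : NonZero s}} W A → ∣ A ∣ ≤ s →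
                               (∀ a → a ∈ A → Close G s W a) →
                               ∣ W ∣ ≤ 2 * ∣ commonNeighboursIn W A ∣
  ∣W∣≤2*∣commonNeighboursIn∣ s W A ∣A∣≤s close =
    ≤2*-from-deficit 2s*deficit≤s*∣W∣ (∣p∣≤∣p∩⋂qs∣+∑∣p∩∁q∣ W neighbourhoods)
    where
    neighbourhoods = map (N G) (elements A)
    deficits = map (λ q → ∣ W ∩ ∁ q ∣) neighbourhoods
    length-deficits : length deficits ≡ ∣ A ∣
    length-deficits = trans (length-map _ neighbourhoods)
                            (trans (length-map (N G) (elements A)) (length-elements A))
    deficits-bounded : All (λ x → 2 * s * x ≤ ∣ W ∣) deficits
    deficits-bounded = All.map⁺ (All.map⁺ (All.tabulate λ {a} a∈ₗ → close a (∈-elements⁻ A a∈ₗ)))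
    2s*deficit≤s*∣W∣ : 2 * s * sum deficits ≤ s * ∣ W ∣
    2s*deficit≤s*∣W∣ = begin
      2 * s * sum deficits     ≤⟨ *-sum≤length* {2 * s} deficits-bounded ⟩
      length deficits * ∣ W ∣  ≡⟨ cong (_* ∣ W ∣) length-deficits ⟩
      ∣ A ∣ * ∣ W ∣            ≤⟨ *-monoˡ-≤ ∣ W ∣ ∣A∣≤s ⟩
      s * ∣ W ∣                ∎
      where open ≤-Reasoning

  biclique : ∀ {s} W A B → ∣ A ∣ ≡ s → ∣ B ∣ ≡ s → B ⊆ commonNeighboursIn W A → ContainsKss G s
  biclique W A B ∣A∣≡s ∣B∣≡s B⊆Γ = A , B , ∣A∣≡s , ∣B∣≡s , disjoint , λ _ _ a∈A b∈B → adjacent a∈A b∈B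
    where
    adjacent : ∀ {a b} → a ∈ A → b ∈ B → adj G a b ≡ true
    adjacent a∈A b∈B = ∈commonNeighboursIn⇒adj a∈A (B⊆Γ b∈B)
    disjoint : Disjoint A B
    disjoint (x , x∈A∩B) with trans (sym (uncurry adjacent (x∈p∩q⁻ A B x∈A∩B))) (irrefl G x)
    ... | ()

  close-set⇒Kss : ∀ s .{{_ : NonZero s}} W → 2 * s ≤ ∣ W ∣ → ∀ A → ∣ A ∣ ≡ s →
                  (∀ a → a ∈ A → Close G s W a) → ContainsKss G s
  close-set⇒Kss s W 2s≤∣W∣ A ∣A∣≡s close =
    let B , B⊆Γ , ∣B∣≡s = subset-of-size s (commonNeighboursIn W A) s≤∣Γ∣
    in  biclique W A B ∣A∣≡s ∣B∣≡s B⊆Γ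
    where
    s≤∣Γ∣ : s ≤ ∣ commonNeighboursIn W A ∣
    s≤∣Γ∣ = *-cancelˡ-≤ 2 (≤-trans 2s≤∣W∣
              (∣W∣≤2*∣commonNeighboursIn∣ s W A (≤-reflexive ∣A∣≡s) close))

claim2p2 : (s : ℕ) → .{{_ : NonZero s}} → {n : ℕ} → (G : Graph n) →
    ¬ ContainsKss G s →
    (W : Subset n) → 2 * s ≤ ∣ W ∣ →
    (U : Subset n) → (∀ v → v ∈ U → Close G s W v) →
    ∣ U ∣ ≤ s
claim2p2 s G K-free W 2s≤∣W∣ U close with ∣ U ∣ ≤? s
... | yes ∣U∣≤s = ∣U∣≤s
... | no ∣U∣≰s =
  let A , A⊆U , ∣A∣≡s = subset-of-size s U (≰⇒≥ ∣U∣≰s)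
  in  contradiction (close-set⇒Kss G s W 2s≤∣W∣ A ∣A∣≡s (λ a a∈A → close a (A⊆U a∈A))) K-free
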